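{- Let $\varphi\in\mathcal L^{\sf PLTL}$ be a formula in which the atom ${\tt whole}$ does not occur. If $\varphi$ is satisfied at some point of some $\sf PLTL$ model based on a bijective frame, then $\varphi^{\rm top}$ is satisfied at some point of a bitopological derivative model $\mathcal M^{\rm top}=(X,d_a,d_b,[\![\cdot]\!])$ (with $d_a,d_b$ the Cantor derivatives of topologies $\mathcal T_a,\mathcal T_b$ on $X$) in which ${\tt Two}$ is true at every point. Moreover, $\mathcal M^{\rm top}$ may be chosen so that both $\mathcal T_a$ and $\mathcal T_b$ are monadic.
   Context: $\mathcal L^{\sf PLTL}$: $\varphi::=p\mid\neg\varphi\mid\varphi\wedge\psi\mid\mathsf X\varphi\mid\mathsf Y\varphi\mid\mathsf F\varphi\mid\mathsf P\varphi$. A bijective frame is $(X,S)$ with $S:X\to X$ a bijection; a $\sf PLTL$ model adds a valuation of atoms. Semantics: $w\models\mathsf X\varphi$ iff $S(w)\models\varphi$; $w\models\mathsf Y\varphi$ iff $S^{ -1}(w)\models\varphi$; $w\models\mathsf F\varphi$ iff $S^k(w)\models\varphi$ for some $k\ge0$; $w\models\mathsf P\varphi$ iff $S^{ -k}(w)\models\varphi$ for some $k\ge0$. Language $\mathcal L^*$: formulas $\varphi::=p\mid\neg\varphi\mid\varphi\wedge\psi\mid\langle\alpha\rangle\varphi$, programs $\alpha::=a\mid\alpha;\beta\mid\alpha\cup\beta\mid\alpha^*$; $[\alpha]\varphi:=\neg\langle\alpha\rangle\neg\varphi$. In a model, $[\![a]\!](Y)=d_a(Y)$, $[\![\alpha;\beta]\!](Y)=[\![\alpha]\!]([\![\beta]\!](Y))$,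 $[\![\alpha\cup\beta]\!](Y)=[\![\alpha]\!](Y)\cup[\![\beta]\!](Y)$, $[\![\alpha^*]\!](Y)=\bigcap\{Z:[\![\alpha]\!](Z)\cup Y\subseteq Z\}$, $[\![\langle\alpha\rangle\varphi]\!]=[\![\alpha]\!]([\![\varphi]\!])$. Cantor derivative: $d_{\mathcal T}(A)=\{y:\text{every }\mathcal T\text{ -neighbourhood of }y\text{ meets }A\setminus\{y\}\}$. A topology is monadic if every open set is closed and it has a base of atomic open sets (nonempty open sets with no nonempty proper open subset); equivalently it is given by the equivalence classes of an equivalence relation. The translation $\cdot^{\rm top}$ fixes atoms, commutes with Booleans, and sets $(\mathsf X\varphi)^{\rm top}=\langle a;b\rangle\varphi^{\rm top}$, $(\mathsf Y\varphi)^{\rm top}=\langle b;a\rangle\varphi^{\rm top}$, $(\mathsf F\varphi)^{\rm top}=\langle(a;b)^*\rangle\varphi^{\rm top}$, $(\mathsf P\varphi)^{\rm top}=\langle(b;a)^*\rangle\varphi^{\rm top}$. With the designated atom ${\tt whole}$, ${\tt Two}_\iota:=({\tt whole}\to([\iota]\neg{\tt whole}\wedge\langle\iota\rangle\neg{\tt whole}))\wedge(\neg{\tt whole}\to([\iota]{\tt whole}\wedge\langle\iota\rangle{\tt whole}))$ for $\iota\in\{a,b\}$, and ${\tt Two}:={\tt Two}_a\wedge{\tt Two}_b$. -}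

module Defs where

open import Level using (Level; 0ℓ; _⊔_) renaming (suc to lsuc)
open import Data.Nat using (ℕ; zero; suc)
open import Data.Product using (Σ; ∃; _×_; _,_)
open import Data.Sum using (_⊎_)
open import Data.Unit using (⊤)
open import Relation.Nullary using (¬_)
open import Relation.Unary using (Pred; _⊆_; ∁; _∪_)
open import Relation.Binary.PropositionalEquality using (_≡_)
open import Function.Bundles using (_↔_; Inverse)

data Atom : Set where
  whole : Atom
  var   : ℕ → Atom

data PLTL : Set where
  atom : Atom → PLTL
  neg  : PLTL → PLTL
  and  : PLTL → PLTL → PLTL
  X Y F P : PLTL → PLTL

Occurs : Atom → PLTL → Set
Occurs p (atom q)  = p ≡ q
Occurs p (neg φ)   = Occurs p φ
Occurs p (and φ ψ) = Occurs p φ ⊎ Occurs p ψ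
Occurs p (X φ)     = Occurs p φ
Occurs p (Y φ)     = Occurs p φ
Occurs p (F φ)     = Occurs p φ
Occurs p (P φ)     = Occurs p φ

iter : {A : Set} → (A → A) → ℕ → A → A
iter f zero    x = x
iter f (suc n) x = f (iter f n x)

record PModel : Set₁ where
  field
    W : Set
    S : W ↔ W
    V : Atom → Pred W 0ℓ

module _ (M : PModel) where
  open PModel M
  open Inverse S renaming (to to succ; from to pred)

  _⊨_ : W → PLTL → Set
  w ⊨ atom p  = V p w
  w ⊨ neg φ   = ¬ (w ⊨ φ)
  w ⊨ and φ ψ = (w ⊨ φ) × (w ⊨ ψ)
  w ⊨ X φ     = succ w ⊨ φ
  w ⊨ Y φ     = pred w ⊨ φ
  w ⊨ F φ     = ∃ λ k → iter succ k w ⊨ φ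
  w ⊨ P φ     = ∃ λ k → iter pred k w ⊨ φ

record Topology (W : Set) : Set₁ where
  field
    IsOpen    : Pred W 0ℓ → Set
    open-ext  : ∀ {U V} → U ⊆ V → V ⊆ U → IsOpen U → IsOpen V
    open-full : IsOpen (λ _ → ⊤)
    open-∩    : ∀ {U V} → IsOpen U → IsOpen V → IsOpen (λ x → U x × V x)
    open-⋃    : (I : Set) (U : I → Pred W 0ℓ) → (∀ i → IsOpen (U i)) →
                IsOpen (λ x → ∃ λ i → U i x)

module _ {W : Set} (T : Topology W) where
  open Topology T

  deriv : ∀ {ℓ} → Pred W ℓ → Pred W (lsuc 0ℓ ⊔ ℓ)
  deriv A y = (U : Pred W 0ℓ) → IsOpen U → U y →
              ∃ λ z → U z × A z × ¬ (z ≡ y)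

  AtomicOpen : Pred W 0ℓ → Set₁
  AtomicOpen U = IsOpen U × (∃ λ x → U x) ×
    ((V : Pred W 0ℓ) → IsOpen V → V ⊆ U → (∃ λ x → V x) → U ⊆ V)

  Monadic : Set₁
  Monadic =
    ((U : Pred W 0ℓ) → IsOpen U → IsOpen (∁ U)) ×
    ((U : Pred W 0ℓ) → IsOpen U → (x : W) → U x →
       Σ (Pred W 0ℓ) λ B → AtomicOpen B × B x × B ⊆ U)

data Idx : Set where
  a b : Idx

data Prog : Set where
  act  : Idx → Prog
  _⨾_  : Prog → Prog → Prog
  _∪ₚ_ : Prog → Prog → Prog
  _*   : Prog → Prog

data Form : Set where
  atom : Atom → Form
  neg  : Form → Form
  and  : Form → Form → Form
  ⟨_⟩_ : Prog → Form → Form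

box : Prog → Form → Form
box α φ = neg (⟨ α ⟩ neg φ)

_⇒_ : Form → Form → Form
φ ⇒ ψ = neg (and φ (neg ψ))

-- Bitopological derivative model: d_a, d_b are Cantor derivatives of T a, T b.
record BiModel : Set₁ where
  field
    W : Set
    T : Idx → Topology W
    V : Atom → Pred W 0ℓ

-- universe levels of interpretations (impredicative intersection for _*)
PL : Prog → Level → Level
PL (act ι)  ℓ = lsuc 0ℓ ⊔ ℓ
PL (α ⨾ β)  ℓ = PL α (PL β ℓ)
PL (α ∪ₚ β) ℓ = PL α ℓ ⊔ PL β ℓ
PL (α *)    ℓ = lsuc ℓ ⊔ PL α ℓ

FL : Form → Level
FL (atom p)    = 0ℓ
FL (neg φ)     = FL φ
FL (and φ ψ)   = FL φ ⊔ FL ψ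
FL (⟨ α ⟩ φ)   = PL α (FL φ)

module _ (M : BiModel) where
  open BiModel M

  ⟦_⟧p : (α : Prog) → ∀ {ℓ} → Pred W ℓ → Pred W (PL α ℓ)
  ⟦ act ι ⟧p  A = deriv (T ι) A
  ⟦ α ⨾ β ⟧p  A = ⟦ α ⟧p (⟦ β ⟧p A)
  ⟦ α ∪ₚ β ⟧p A = ⟦ α ⟧p A ∪ ⟦ β ⟧p A
  ⟦ α * ⟧p {ℓ} A = λ x → (Z : Pred W ℓ) → ⟦ α ⟧p Z ⊆ Z → A ⊆ Z → Z x

  ⟦_⟧ : (φ : Form) → Pred W (FL φ)
  ⟦ atom p ⟧  = V p
  ⟦ neg φ ⟧   = ∁ ⟦ φ ⟧
  ⟦ and φ ψ ⟧ = λ x → ⟦ φ ⟧ x × ⟦ ψ ⟧ x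
  ⟦ ⟨ α ⟩ φ ⟧ = ⟦ α ⟧p ⟦ φ ⟧

top : PLTL → Form
top (atom p)  = atom p
top (neg φ)   = neg (top φ)
top (and φ ψ) = and (top φ) (top ψ)
top (X φ)     = ⟨ act a ⨾ act b ⟩ top φ
top (Y φ)     = ⟨ act b ⨾ act a ⟩ top φ
top (F φ)     = ⟨ (act a ⨾ act b) * ⟩ top φ
top (P φ)     = ⟨ (act b ⨾ act a) * ⟩ top φ

Two-ι : Idx → Form
Two-ι ι = and (atom whole ⇒ and (box (act ι) (neg (atom whole))) (⟨ act ι ⟩ neg (atom whole)))
              (neg (atom whole) ⇒ and (box (act ι) (atom whole)) (⟨ act ι ⟩ atom whole))

Two : Form
Two = and (Two-ι a) (Two-ι b)

{-# OPTIONS --safe #-}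
-- Double the frame: take two copies of X and let whole hold on the upper one. Give each
-- modality the topology whose atoms are the two-point orbits of a fixed-point-free
-- involution; such a topology is monadic and its Cantor derivative is the preimage under
-- the involution. The a-involution swaps the two copies of each point, the b-involution
-- joins the lower copy of v to the upper copy of S v. Both swap the copies, which gives
-- Two, and on the upper copy a;b acts as S and b;a as S⁻¹, so φᵗᵒᵖ holds at the upper
-- copy of v exactly when φ holds at v.
module Submission where

open import Defs
open import Level using (0ℓ; Setω)
open import Data.Bool using (Bool; true; false; not)
open import Data.Bool.Properties using (not-involutive)
open import Data.Empty using (⊥-elim)
open import Data.Nat using (ℕ; zero; suc)
open import Data.Product using (Σ; ∃; _×_; _,_)
open import Data.Product.Function.Dependent.Propositional using (congˡ)
open import Data.Product.Function.NonDependent.Propositional using (_×-⇔_)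
open import Data.Sum using (_⊎_; inj₁; inj₂)
open import Data.Unit using (tt)
open import Function.Base using (_∘_)
open import Function.Bundles using (Inverse; _⇔_; mk⇔; Equivalence)
open import Function.Properties.Equivalence using ()
  renaming (refl to ⇔-refl; trans to ⇔-trans)
open import Function.Related.Propositional using (K-reflexive)
open import Function.Related.TypeIsomorphisms using (¬-cong-⇔)
open import Relation.Nullary using (¬_)
open import Relation.Unary using (Pred; _⊆_; ∁)
open import Relation.Binary.PropositionalEquality using (_≡_; refl; sym; trans; cong; subst)

open Equivalence using (to; from)

iter-suc : {A : Set} (f : A → A) (k : ℕ) (x : A) → iter f (suc k) x ≡ iter f k (f x)
iter-suc f zero    x = refl
iter-suc f (suc k) x = cong f (iter-suc f k x)

iter-natural : {A B : Set} {f : A → A} {g : B → B} (h : A → B) →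
               (∀ x → g (h x) ≡ h (f x)) → ∀ k x → iter g k (h x) ≡ h (iter f k x)
iter-natural h comm zero    x = refl
iter-natural {f = f} {g} h comm (suc k) x =
  trans (cong g (iter-natural h comm k x)) (comm (iter f k x))

module FixedPointFreeInvolution {W : Set} (p : W → W)
  (involutive : ∀ x → p (p x) ≡ x) (fixpoint-free : ∀ x → ¬ p x ≡ x) where

  Invariant : Pred W 0ℓ → Set
  Invariant U = ∀ x → U x → U (p x)

  orbitTopology : Topology W
  orbitTopology = record
    { IsOpen    = Invariant
    ; open-ext  = λ U⊆V V⊆U invU x Vx → U⊆V (invU x (V⊆U Vx))
    ; open-full = λ _ _ → tt
    ; open-∩    = λ invU invV x (Ux , Vx) → invU x Ux , invV x Vx
    ; open-⋃    = λ I U invU x (i , Uix) → i , invU i x Uix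
    }

  orbit : W → Pred W 0ℓ
  orbit x y = y ≡ x ⊎ y ≡ p x

  orbit-invariant : ∀ x → Invariant (orbit x)
  orbit-invariant x y (inj₁ refl) = inj₂ refl
  orbit-invariant x y (inj₂ refl) = inj₁ (involutive x)

  orbit-least : ∀ {U x} → Invariant U → U x → orbit x ⊆ U
  orbit-least invU Ux (inj₁ refl) = Ux
  orbit-least invU Ux (inj₂ refl) = invU _ Ux

  invariant-∁ : ∀ {U} → Invariant U → Invariant (∁ U)
  invariant-∁ {U} invU x ¬Ux Upx = ¬Ux (subst U (involutive x) (invU (p x) Upx))

  orbit-atomic : ∀ x → AtomicOpen orbitTopology (orbit x)
  orbit-atomic x = orbit-invariant x , (x , inj₁ refl) , atomic
    where
    atomic : ∀ V → Invariant V → V ⊆ orbit x → (∃ λ y → V y) → orbit x ⊆ V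
    atomic V invV V⊆orbit (y , Vy) with V⊆orbit Vy
    ... | inj₁ refl = orbit-least invV Vy
    ... | inj₂ refl = orbit-least invV (subst V (involutive x) (invV _ Vy))

  orbitTopology-monadic : Monadic orbitTopology
  orbitTopology-monadic =
    (λ U → invariant-∁) ,
    (λ U invU x Ux → orbit x , orbit-atomic x , inj₁ refl , orbit-least invU Ux)

  deriv-orbitTopology : ∀ {ℓ} (A : Pred W ℓ) y → deriv orbitTopology A y ⇔ A (p y)
  deriv-orbitTopology A y =
    mk⇔ into (λ Apy U invU Uy → p y , invU y Uy , Apy , fixpoint-free y)
    where
    into : deriv orbitTopology A y → A (p y)
    into y∈dA with y∈dA (orbit y) (orbit-invariant y) (inj₁ refl)
    ... | z , inj₁ z≡y , _  , z≢y = ⊥-elim (z≢y z≡y)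
    ... | z , inj₂ refl , Az , _  = Az

module Semantics (N : BiModel) where
  open BiModel N

  record Preimage (γ : Prog) (g : W → W) : Setω where
    constructor mkPreimage
    field preimage-⇔ : ∀ {ℓ} (Z : Pred W ℓ) x → ⟦_⟧p N γ Z x ⇔ Z (g x)
  open Preimage public

  preimage-⨾ : ∀ {α β f g} → Preimage α f → Preimage β g → Preimage (α ⨾ β) (g ∘ f)
  preimage-⨾ {β = β} {f} α≈f β≈g =
    mkPreimage λ Z x → ⇔-trans (preimage-⇔ α≈f (⟦_⟧p N β Z) x) (preimage-⇔ β≈g Z (f x))

  preimage-* : ∀ {γ g} → Preimage γ g →
               ∀ {ℓ} (A : Pred W ℓ) x → ⟦_⟧p N (γ *) A x ⇔ ∃ λ k → A (iter g k x)
  preimage-* {γ} {g} γ≈g {ℓ} A x =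
    mk⇔ (λ x∈γ*A → x∈γ*A Reach closed (λ Ay → zero , Ay)) (λ (k , Ak) → reached k x Ak)
    where
    Reach : Pred W ℓ
    Reach y = ∃ λ k → A (iter g k y)

    closed : ⟦_⟧p N γ Reach ⊆ Reach
    closed {y} y∈γReach with to (preimage-⇔ γ≈g Reach y) y∈γReach
    ... | k , Ak = suc k , subst A (sym (iter-suc g k y)) Ak

    reached : ∀ k y → A (iter g k y) → ⟦_⟧p N (γ *) A y
    reached zero    y Ay Z closedZ A⊆Z = A⊆Z Ay
    reached (suc k) y Ak Z closedZ A⊆Z =
      closedZ (from (preimage-⇔ γ≈g Z y)
                    (reached k (g y) (subst A (iter-suc g k y) Ak) Z closedZ A⊆Z))

  box-dia-preimage : ∀ {ι p} → Preimage (act ι) p → ∀ ψ {x} →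
                     ⟦_⟧ N ψ (p x) → ⟦_⟧ N (and (box (act ι) ψ) (⟨ act ι ⟩ ψ)) x
  box-dia-preimage ι≈p ψ {x} ψpx =
    (λ ◇¬ψx → to (preimage-⇔ ι≈p _ x) ◇¬ψx ψpx) , from (preimage-⇔ ι≈p _ x) ψpx

  Two-ι-of-swap : ∀ {ι p} → Preimage (act ι) p →
                  (∀ x → V whole (p x) ⇔ (¬ V whole x)) → ∀ x → ⟦_⟧ N (Two-ι ι) x
  Two-ι-of-swap ι≈p swap x =
    (λ (wx , ¬box-dia) →
       ¬box-dia (box-dia-preimage ι≈p (neg (atom whole)) (λ wpx → to (swap x) wpx wx))) ,
    (λ (¬wx , ¬box-dia) →
       ¬box-dia (box-dia-preimage ι≈p (atom whole) (from (swap x) ¬wx)))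

not-≡-true : ∀ t → (not t ≡ true) ⇔ (¬ t ≡ true)
not-≡-true false = mk⇔ (λ _ ()) (λ _ → refl)
not-≡-true true  = mk⇔ (λ ()) (λ ¬true → ⊥-elim (¬true refl))

module Doubling (M : PModel) where
  open PModel M
  open Inverse S renaming (to to succ; from to pred)

  Point : Set
  Point = W × Bool

  embed : W → Point
  embed v = v , true

  involution : Idx → Point → Point
  involution a (v , t)     = v , not t
  involution b (v , false) = succ v , true
  involution b (v , true)  = pred v , false

  involution-involutive : ∀ ι x → involution ι (involution ι x) ≡ x
  involution-involutive a (v , t)     = cong (v ,_) (not-involutive t)
  involution-involutive b (v , false) = cong (_, false) (strictlyInverseʳ v)
  involution-involutive b (v , true)  = cong (_, true) (strictlyInverseˡ v)

  involution-fixpoint-free : ∀ ι x → ¬ involution ι x ≡ x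
  involution-fixpoint-free a (v , false) ()
  involution-fixpoint-free a (v , true)  ()
  involution-fixpoint-free b (v , false) ()
  involution-fixpoint-free b (v , true)  ()

  module Orbits (ι : Idx) =
    FixedPointFreeInvolution (involution ι)
      (involution-involutive ι) (involution-fixpoint-free ι)

  valuation : Atom → Pred Point 0ℓ
  valuation whole   (v , t) = t ≡ true
  valuation (var n) (v , t) = V (var n) v

  doubled : BiModel
  doubled = record { W = Point ; T = Orbits.orbitTopology ; V = valuation }

  open Semantics doubled

  act-preimage : ∀ ι → Preimage (act ι) (involution ι)
  act-preimage ι = mkPreimage (Orbits.deriv-orbitTopology ι)

  involution-swaps-whole : ∀ ι x →
                           valuation whole (involution ι x) ⇔ (¬ valuation whole x)
  involution-swaps-whole a (v , t)     = not-≡-true t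
  involution-swaps-whole b (v , false) = not-≡-true false
  involution-swaps-whole b (v , true)  = not-≡-true true

  star-embed : ∀ {γ g} {f : W → W} → Preimage γ g → (∀ v → g (embed v) ≡ embed (f v)) →
               ∀ {ℓ} (A : Pred Point ℓ) v →
               ⟦_⟧p doubled (γ *) A (embed v) ⇔ ∃ λ k → A (embed (iter f k v))
  star-embed γ≈g comm A v =
    ⇔-trans (preimage-* γ≈g A (embed v))
            (congˡ (λ {k} → K-reflexive (cong A (iter-natural embed comm k v))))

  next : Preimage (act a ⨾ act b) (involution b ∘ involution a)
  next = preimage-⨾ (act-preimage a) (act-preimage b)

  previous : Preimage (act b ⨾ act a) (involution a ∘ involution b)
  previous = preimage-⨾ (act-preimage b) (act-preimage a)

  top-correct : ∀ φ → ¬ Occurs whole φ → ∀ v →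
                ⟦_⟧ doubled (top φ) (embed v) ⇔ _⊨_ M v φ
  top-correct (atom whole)   no v = ⊥-elim (no refl)
  top-correct (atom (var n)) no v = ⇔-refl
  top-correct (neg φ)        no v = ¬-cong-⇔ (top-correct φ no v)
  top-correct (and φ ψ)      no v =
    top-correct φ (no ∘ inj₁) v ×-⇔ top-correct ψ (no ∘ inj₂) v
  top-correct (X φ) no v =
    ⇔-trans (preimage-⇔ next _ (embed v)) (top-correct φ no (succ v))
  top-correct (Y φ) no v =
    ⇔-trans (preimage-⇔ previous _ (embed v)) (top-correct φ no (pred v))
  top-correct (F φ) no v =
    ⇔-trans (star-embed next (λ _ → refl) _ v) (congˡ (top-correct φ no _))
  top-correct (P φ) no v =
    ⇔-trans (star-embed previous (λ _ → refl) _ v) (congˡ (top-correct φ no _))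

mainTheorem6 : (φ : PLTL) → ¬ Occurs whole φ →
    (M : PModel) (w : PModel.W M) → _⊨_ M w φ →
    Σ BiModel λ N →
      (∃ λ x → ⟦_⟧ N (top φ) x) ×
      ((x : BiModel.W N) → ⟦_⟧ N Two x) ×
      Monadic (BiModel.T N a) × Monadic (BiModel.T N b)
mainTheorem6 φ no M w w⊨φ =
  doubled ,
  (embed w , from (top-correct φ no w) w⊨φ) ,
  (λ x → two a x , two b x) ,
  Orbits.orbitTopology-monadic a , Orbits.orbitTopology-monadic b
  where
  open Doubling M
  open Semantics doubled
  two : ∀ ι x → ⟦_⟧ doubled (Two-ι ι) x
  two ι = Two-ι-of-swap (act-preimage ι) (involution-swaps-whole ι)
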